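{- For any simple temporal graph $\mathcal{G}=(V,E,\lambda)$ with lifetime $T_{\max}$ and any $\delta,k\in\mathbb{N}^+$, the witness complexity of the instance $(\mathcal{G},T_{\max},\delta,k)$ is at most $|E|$.
   Context: A simple temporal graph $\mathcal{G}=(V,E,\lambda)$ with lifetime $T_{\max}$ has a finite undirected static graph $(V,E)$ and labeling $\lambda:E\to\{1,\dots,T_{\max}\}$. Infection model with parameter $\delta$: all nodes start susceptible; a seed infection $(v,t)$ makes $v$ infected at time $t$; otherwise a susceptible node $u$ becomes infected at time $t$ iff some node $w$ infectious at time $t$ has an edge $uw$ with $\lambda(uw)=t$ (if several, exactly one infects $u$); a node infected at time $t$ is infectious at times $t+1,\dots,t+\delta$ and resistant afterwards. An infection log is the set of triples $(u,w,s)$ ($u$ infected $w$ at time $s$; seeds as $(u,u,s)$). A witnessing schedule of length $a$ for $\mathcal{G}$ is a sequence $S_1,\dots,S_a$ of seed infection sets (each of size at most $k$) such that after performing $a$ rounds with these seed sets on $\mathcal{G}$, all labels of $\mathcal{G}$ are uniquely determined (among labelings of the same static graph) by the resulting infection logs. The witness complexity is the length of the shortest witnessing schedule. -}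

module Defs where

open import Data.Nat using (ℕ; _≤_; _<_; _+_)
open import Data.Fin using (Fin; toℕ)
open import Data.Product using (_×_; _,_; proj₁; proj₂; ∃; ∃-syntax)
open import Data.Sum using (_⊎_)
open import Data.Maybe using (Maybe; just; nothing)
open import Data.List using (List; length)
open import Data.List.Membership.Propositional using (_∈_)
open import Relation.Binary.PropositionalEquality using (_≡_)
open import Relation.Nullary using (¬_)

-- Each edge is stored with its
-- endpoints in increasing order (this rules out loops and fixes an orientation),
-- and distinct edge indices have distinct endpoint pairs (no multi-edges).
record StaticGraph : Set where
  field
    n        : ℕ
    m        : ℕ
    ends     : Fin m → Fin n × Fin n
    ordered  : ∀ e → toℕ (proj₁ (ends e)) < toℕ (proj₂ (ends e))
    distinct : ∀ e e′ → ends e ≡ ends e′ → e ≡ e′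

open StaticGraph public

Labeling : StaticGraph → Set
Labeling G = Fin (m G) → ℕ

IsLabeling : (G : StaticGraph) → (Tmax : ℕ) → Labeling G → Set
IsLabeling G Tmax lab = ∀ e → (1 ≤ lab e) × (lab e ≤ Tmax)

Joins : (G : StaticGraph) → Fin (m G) → Fin (n G) → Fin (n G) → Set
Joins G e u w = (ends G e ≡ (u , w)) ⊎ (ends G e ≡ (w , u))

Seeds : ℕ → Set
Seeds n = List (Fin n × ℕ)

-- The outcome of one round: for every node either "never infected" (nothing)
-- or just (w , s): infected at time s by w (w = v for a seed infection).
-- This is exactly the infection log {(w , v , s) | f v ≡ just (w , s)}.
Outcome : ℕ → Set
Outcome n = Fin n → Maybe (Fin n × ℕ)

InfectiousAt : {n : ℕ} → (δ : ℕ) → Outcome n → Fin n → ℕ → Set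
InfectiousAt δ f w t = ∃[ p ] ∃[ s ] ((f w ≡ just (p , s)) × (s < t) × (t ≤ s + δ))

ExposedAt : (G : StaticGraph) → Labeling G → ℕ → Outcome (n G) → Fin (n G) → ℕ → Set
ExposedAt G lab δ f v t =
  ∃[ e ] ∃[ w ] (Joins G e v w × (lab e ≡ t) × InfectiousAt δ f w t)

TriggeredAt : (G : StaticGraph) → Labeling G → ℕ → Seeds (n G) → Outcome (n G) → Fin (n G) → ℕ → Set
TriggeredAt G lab δ S f v t = ((v , t) ∈ S) ⊎ ExposedAt G lab δ f v t

-- A susceptible node gets infected at the first time
-- it is triggered, by a seed or by exactly one (arbitrarily chosen) infectious
-- neighbour over an edge with the current label; nodes are infected at most once.
ValidRun : (G : StaticGraph) → Labeling G → ℕ → Seeds (n G) → Outcome (n G) → Set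
ValidRun G lab δ S f = ∀ v →
    ((f v ≡ nothing) → ∀ t → ¬ TriggeredAt G lab δ S f v t)
  × (∀ w s → f v ≡ just (w , s) →
       (∀ t → t < s → ¬ TriggeredAt G lab δ S f v t)
     × (((w ≡ v) × ((v , s) ∈ S))
        ⊎ (∃[ e ] (Joins G e v w × (lab e ≡ s) × InfectiousAt δ f w s))))

WitnessingSchedule : (G : StaticGraph) → (Tmax δ k : ℕ) → Labeling G →
                     (a : ℕ) → (Fin a → Seeds (n G)) → Set
WitnessingSchedule G Tmax δ k lab a S =
    (∀ i → length (S i) ≤ k)
  × (∀ (logs : Fin a → Outcome (n G)) →
       (∀ i → ValidRun G lab δ (S i) (logs i)) →
       ∀ (lab′ : Labeling G) → IsLabeling G Tmax lab′ →
       (∀ i → ValidRun G lab′ δ (S i) (logs i)) →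
       ∀ e → lab′ e ≡ lab e)

WitnessComplexity≤ : (G : StaticGraph) → (Tmax δ k : ℕ) → Labeling G → ℕ → Set
WitnessComplexity≤ G Tmax δ k lab b =
  ∃[ a ] ((a ≤ b) × ∃[ S ] WitnessingSchedule G Tmax δ k lab a S)

{-# OPTIONS --safe #-}
module Submission where

open import Defs
open import Data.Nat using (ℕ; _≤_; suc; pred; _<_; _≤?_; >-nonZero)
open import Data.Nat.Properties
  using (≤-refl; ≤-trans; ≤-antisym; ≤-reflexive; <⇒≤; ≤-pred; ≰⇒>; <-irrefl; <-asym;
         m<m+n; m≤n⇒m<n∨m≡n; suc-pred)
open import Data.Nat.Induction using (<-rec)
open import Data.Fin using (Fin; toℕ)
open import Data.Product using (_×_; _,_; proj₁; proj₂; ∃-syntax)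
open import Data.Sum using (inj₁; inj₂)
open import Data.Maybe using (just; nothing)
open import Data.List using ([_])
open import Data.List.Relation.Unary.Any using (here)
open import Relation.Binary.PropositionalEquality
  using (_≡_; _≢_; refl; sym; trans; cong; subst; module ≡-Reasoning)
open import Relation.Nullary using (yes; no)
open import Data.Empty using (⊥-elim)

-- Round e seeds the smaller endpoint u of e at time λ(e) − 1.  Nothing is infected
-- before the seed and only u at the seed time, so the other endpoint w is infected
-- exactly at λ(e), over e (this needs δ ≥ 1).  Any labeling λ′ explaining the same
-- log must then give w an infector infected at λ(e) − 1, i.e. u, over an edge with
-- label λ(e); since the graph is simple that edge is e, so λ′(e) = λ(e).

module ValidRunProperties (G : StaticGraph) (lab : Labeling G) (δ : ℕ)
  (S : Seeds (n G)) (f : Outcome (n G)) (valid : ValidRun G lab δ S f) where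

  infected-by-trigger : ∀ {v t} → TriggeredAt G lab δ S f v t →
    ∃[ p ] ∃[ s ] (f v ≡ just (p , s)) × (s ≤ t)
  infected-by-trigger {v} {t} triggered with f v in eq
  ... | nothing = ⊥-elim (proj₁ (valid v) eq t triggered)
  ... | just (p , s) with s ≤? t
  ...   | yes s≤t = p , s , refl , s≤t
  ...   | no s≰t = ⊥-elim (proj₁ (proj₂ (valid v) p s eq) t (≰⇒> s≰t) triggered)

infectious-after-infection : ∀ {n δ} {f : Outcome n} {w p s} → 1 ≤ δ →
  f w ≡ just (p , s) → InfectiousAt δ f w (suc s)
infectious-after-infection {s = s} δ≥1 eq = _ , s , eq , ≤-refl , m<m+n s δ≥1

joins-ends⇒≡ : ∀ G e e′ → Joins G e′ (proj₂ (ends G e)) (proj₁ (ends G e)) → e′ ≡ e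
joins-ends⇒≡ G e e′ (inj₁ flipped) =
  ⊥-elim (<-asym (ordered G e)
    (subst (λ uw → toℕ (proj₁ uw) < toℕ (proj₂ uw)) flipped (ordered G e′)))
joins-ends⇒≡ G e e′ (inj₂ same) = distinct G e′ e same

module SingleSeedRun (G : StaticGraph) (lab : Labeling G) (δ : ℕ)
  (u : Fin (n G)) (t₀ : ℕ) (f : Outcome (n G)) (valid : ValidRun G lab δ [ (u , t₀) ] f) where

  open ValidRunProperties G lab δ [ (u , t₀) ] f valid

  infected-after-seed : ∀ {v p s} → f v ≡ just (p , s) → t₀ ≤ s
  infected-after-seed {v} {p} {s} = <-rec InfectedAfter step s v p
    where
    InfectedAfter : ℕ → Set
    InfectedAfter s = ∀ v p → f v ≡ just (p , s) → t₀ ≤ s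

    step : ∀ s → (∀ {s′} → s′ < s → InfectedAfter s′) → InfectedAfter s
    step s ih v p eq with proj₂ (proj₂ (valid v) p s eq)
    ... | inj₁ (_ , here seed) = ≤-reflexive (sym (cong proj₂ seed))
    ... | inj₂ (_ , _ , _ , q , _ , eq′ , s′<s , _) = ≤-trans (ih s′<s p q eq′) (<⇒≤ s′<s)

  infected-by-seed-time⇒at-seed-time : ∀ {v p s} → f v ≡ just (p , s) → s ≤ t₀ →
    f v ≡ just (p , t₀)
  infected-by-seed-time⇒at-seed-time {p = p} eq s≤t₀ =
    trans eq (cong (λ s → just (p , s)) (≤-antisym s≤t₀ (infected-after-seed eq)))

  infected-at-seed-time⇒seed : ∀ {v p} → f v ≡ just (p , t₀) → (v ≡ u) × (p ≡ u)
  infected-at-seed-time⇒seed {v} {p} eq with proj₂ (proj₂ (valid v) p t₀ eq)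
  ... | inj₁ (p≡v , here seed) = cong proj₁ seed , trans p≡v (cong proj₁ seed)
  ... | inj₂ (_ , _ , _ , _ , _ , eq′ , s<t₀ , _) =
    ⊥-elim (<-irrefl refl (≤-trans s<t₀ (infected-after-seed eq′)))

  seed-infected : ∃[ p ] f u ≡ just (p , t₀)
  seed-infected with infected-by-trigger {u} {t₀} (inj₁ (here refl))
  ... | p , _ , eq , s≤t₀ = p , infected-by-seed-time⇒at-seed-time eq s≤t₀

  triggered-at-next-step⇒infected-at-next-step : ∀ {v} → v ≢ u →
    TriggeredAt G lab δ [ (u , t₀) ] f v (suc t₀) → ∃[ p ] f v ≡ just (p , suc t₀)
  triggered-at-next-step⇒infected-at-next-step v≢u triggered with infected-by-trigger triggered
  ... | p , s , eq , s≤ with m≤n⇒m<n∨m≡n s≤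
  ...   | inj₂ s≡ = p , trans eq (cong (λ s → just (p , s)) s≡)
  ...   | inj₁ s< =
    ⊥-elim (v≢u (proj₁ (infected-at-seed-time⇒seed (infected-by-seed-time⇒at-seed-time eq (≤-pred s<)))))

  infected-at-next-step⇒edge-to-seed : ∀ {v p} → v ≢ u → f v ≡ just (p , suc t₀) →
    ∃[ e ] Joins G e v u × (lab e ≡ suc t₀)
  infected-at-next-step⇒edge-to-seed {v} {p} v≢u eq with proj₂ (proj₂ (valid v) p (suc t₀) eq)
  ... | inj₁ (_ , here seed) = ⊥-elim (v≢u (cong proj₁ seed))
  ... | inj₂ (e , joins , lab-e , _ , _ , eq′ , s<t , _) =
    e , subst (Joins G e v) p≡u joins , lab-e
    where
    p≡u : p ≡ u
    p≡u = proj₁ (infected-at-seed-time⇒seed (infected-by-seed-time⇒at-seed-time eq′ (≤-pred s<t)))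

edgeSchedule : (G : StaticGraph) → Labeling G → Fin (m G) → Seeds (n G)
edgeSchedule G lab e = [ (proj₁ (ends G e) , pred (lab e)) ]

edgeSchedule-determines-label : (G : StaticGraph) {δ : ℕ} (lab lab′ : Labeling G) →
  (f : Outcome (n G)) → ∀ e → 1 ≤ lab e → 1 ≤ δ →
  ValidRun G lab δ (edgeSchedule G lab e) f → ValidRun G lab′ δ (edgeSchedule G lab e) f →
  lab′ e ≡ lab e
edgeSchedule-determines-label G {δ} lab lab′ f e lab-e≥1 δ≥1 valid valid′ =
  label-via-edge-to-seed (Run′.infected-at-next-step⇒edge-to-seed w≢u
    (proj₂ (Run.triggered-at-next-step⇒infected-at-next-step w≢u w-triggered)))
  where
  u = proj₁ (ends G e)
  w = proj₂ (ends G e)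

  module Run = SingleSeedRun G lab δ u (pred (lab e)) f valid
  module Run′ = SingleSeedRun G lab′ δ u (pred (lab e)) f valid′

  w≢u : w ≢ u
  w≢u w≡u = <-irrefl (cong toℕ (sym w≡u)) (ordered G e)

  suc-pred-lab : suc (pred (lab e)) ≡ lab e
  suc-pred-lab = suc-pred (lab e) {{>-nonZero lab-e≥1}}

  w-triggered : TriggeredAt G lab δ (edgeSchedule G lab e) f w (suc (pred (lab e)))
  w-triggered = inj₂ (e , u , inj₂ refl , sym suc-pred-lab ,
                      infectious-after-infection {f = f} δ≥1 (proj₂ Run.seed-infected))

  label-via-edge-to-seed : ∃[ e′ ] Joins G e′ w u × (lab′ e′ ≡ suc (pred (lab e))) →
    lab′ e ≡ lab e
  label-via-edge-to-seed (e′ , joins , lab′-e′) =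
    begin
      lab′ e               ≡⟨ cong lab′ (sym (joins-ends⇒≡ G e e′ joins)) ⟩
      lab′ e′              ≡⟨ lab′-e′ ⟩
      suc (pred (lab e))   ≡⟨ suc-pred-lab ⟩
      lab e                ∎
    where open ≡-Reasoning

theorem6 : (G : StaticGraph) (Tmax δ k : ℕ) (lab : Labeling G) →
    IsLabeling G Tmax lab → 1 ≤ δ → 1 ≤ k →
    WitnessComplexity≤ G Tmax δ k lab (m G)
theorem6 G Tmax δ k lab isLabeling δ≥1 k≥1 =
  m G , ≤-refl , edgeSchedule G lab , (λ _ → k≥1) ,
  λ logs valid lab′ _ valid′ e →
    edgeSchedule-determines-label G lab lab′ (logs e) e (proj₁ (isLabeling e)) δ≥1
      (valid e) (valid′ e)
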